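{- Let $G=(V,E)$ be a graph on $n$ vertices, and let $\mathcal{N}(G)=\{N[F] : F \text{ is a fort of } G\}$. Then $|\mathcal{N}(G)|\le 2^n-\mathcal{P}(G;1)$.
   Context: Graphs are finite and simple. For $S\subseteq V$, color the vertices of $S$; then (domination step) every neighbor of a vertex of $S$ becomes colored; then repeatedly (forcing steps), whenever a colored vertex has exactly one uncolored neighbor, that neighbor becomes colored, until no more changes occur. $S$ is a power dominating set if all vertices end up colored; $p(G;i)$ is the number of power dominating sets of size $i$, and $\mathcal{P}(G;x)=\sum_{i=1}^n p(G;i)x^i$ is the power domination polynomial. A fort of $G$ is a nonempty set $F\subseteq V$ such that no vertex outside $F$ is adjacent to exactly one vertex of $F$. For $F\subseteq V$, $N[F]$ is the union of the closed neighborhoods $N[v]=N(v)\cup\{v\}$ over $v\in F$. -}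

module Defs where

open import Data.Nat using (ℕ; zero; suc)
open import Data.Bool using (Bool; true; false; _∧_; _∨_; not; if_then_else_)
open import Data.Fin using (Fin; _≟_)
open import Data.Vec using (Vec; []; _∷_; lookup; tabulate; map)
open import Data.Fin.Subset using (Subset; ⁅_⁆)
open import Data.List using (List; []; _∷_; _++_; allFin; length; filterᵇ)
open import Data.Bool.ListAction using (any; all)
import Data.List as L
open import Relation.Nullary.Decidable using (⌊_⌋)
open import Relation.Binary.PropositionalEquality using (_≡_)

record Graph (n : ℕ) : Set where
  field
    adj    : Fin n → Fin n → Bool
    sym    : ∀ u v → adj u v ≡ adj v u
    irrefl : ∀ v → adj v v ≡ false

open Graph public

module _ {n : ℕ} (G : Graph n) where

  mem : Fin n → Subset n → Bool
  mem v S = lookup S v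

  closedNbhd : Subset n → Subset n
  closedNbhd S = tabulate λ v →
    mem v S ∨ any (λ u → mem u S ∧ adj G u v) (allFin n)

  -- one (parallel) round of forcing: v becomes coloured if some coloured
  -- neighbour u of v has v as its only uncoloured neighbour
  forceStep : Subset n → Subset n
  forceStep C = tabulate λ v →
    mem v C ∨ any (λ u → mem u C ∧ adj G u v ∧
                     all (λ w → not (adj G u w) ∨ ⌊ w ≟ v ⌋ ∨ mem w C) (allFin n))
                  (allFin n)

  iterate : ℕ → (Subset n → Subset n) → Subset n → Subset n
  iterate zero    f x = x
  iterate (suc k) f x = iterate k f (f x)

  -- final coloured set: domination step, then forcing until no change
  -- (n rounds suffice, since each non-final round colours a new vertex)
  observed : Subset n → Subset n
  observed S = iterate n forceStep (closedNbhd S)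

  isPowerDominating : Subset n → Bool
  isPowerDominating S = all (λ v → mem v (observed S)) (allFin n)

  nbrCount : Subset n → Fin n → ℕ
  nbrCount F v = length (filterᵇ (λ u → mem u F ∧ adj G v u) (allFin n))

  isOne : ℕ → Bool
  isOne (suc zero) = true
  isOne _          = false

  isFort : Subset n → Bool
  isFort F = any (λ v → mem v F) (allFin n)
           ∧ all (λ v → mem v F ∨ not (isOne (nbrCount F v))) (allFin n)

allSubsets : (n : ℕ) → List (Subset n)
allSubsets zero    = [] ∷ []
allSubsets (suc n) = L.map (true ∷_) (allSubsets n) ++ L.map (false ∷_) (allSubsets n)

subsetEq : {n : ℕ} → Subset n → Subset n → Bool
subsetEq []       []       = true
subsetEq (x ∷ xs) (y ∷ ys) = ⌊ x Data.Bool.≟ y ⌋ ∧ subsetEq xs ys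

count : {A : Set} → (A → Bool) → List A → ℕ
count p xs = length (filterᵇ p xs)

module _ {n : ℕ} (G : Graph n) where

  powerDomCoeff1 : ℕ
  powerDomCoeff1 = count (λ v → isPowerDominating G ⁅ v ⁆) (allFin n)

  fortNbhdCount : ℕ
  fortNbhdCount = count (λ X → any (λ F → isFort G F ∧ subsetEq (closedNbhd G F) X)
                                   (allSubsets n))
                        (allSubsets n)

-- A coloured vertex u that forces a vertex w of a fort F, while the coloured set is disjoint
-- from F, lies outside F and has w as its only neighbour in F (its other neighbours are
-- coloured), which a fort forbids; so a coloured set disjoint from F stays disjoint from F.
-- If {v} is power dominating, N[v] must therefore meet every fort F, i.e. v ∈ N[F]. Hence
-- every member of 𝒩(G) contains the set D of such v, |D| = 𝒫(G;1), and there are only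
-- 2 ^ (n ∸ |D|) ≤ 2 ^ n ∸ |D| supersets of D.
module Submission where

open import Data.Bool using (Bool; true; false; T; not; T?; _∧_; _∨_)
open import Data.Bool.Properties using (T-∧; T-∨; T-≡)
open import Data.Bool.ListAction using (any; all)
open import Data.Empty using (⊥; ⊥-elim)
open import Data.Fin using (Fin; zero; suc; _≟_)
open import Data.Fin.Properties using (suc-injective)
open import Data.Fin.Subset using (Subset; _∈_; _∉_; Nonempty; ⁅_⁆)
open import Data.Fin.Subset.Properties using (drop-there; x∈⁅y⁆⇒x≡y; _∈?_)
open import Data.List using (List; []; _∷_; _++_; length; filterᵇ; allFin; tabulate)
import Data.List as List
open import Data.List.Properties using (length-++; length-filter; filter-++; filter-accept; filter-reject; map-tabulate)
open import Data.List.Membership.Propositional.Properties using (∈-allFin)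
open import Data.List.Relation.Unary.All as All using ()
open import Data.List.Relation.Unary.All.Properties using (all⁺)
open import Data.List.Relation.Unary.Any using (satisfied)
open import Data.List.Relation.Unary.Any.Properties using (any⁺; any⁻)
open import Data.List.Membership.Propositional using (lose)
open import Data.Nat using (ℕ; zero; suc; _+_; _≤_; _∸_; _^_)
open import Data.Nat.Properties using (+-identityʳ; +-mono-≤; m≤m+n; m^n>0; m+n≤o⇒m≤o∸n; ≤-reflexive; ≤-trans; module ≤-Reasoning)
open import Data.Nat.Tactic.RingSolver using (solve-∀)
open import Data.Product using (∃; _×_; _,_; proj₁; proj₂)
open import Data.Sum as Sum using (_⊎_; inj₁; inj₂)
open import Data.Vec using ([]; _∷_; lookup)
import Data.Vec as Vec
open import Data.Vec.Properties using (lookup∘tabulate; []=⇒lookup; lookup⇒[]=)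
open import Function using (id; _∘_; Equivalence)
open import Relation.Binary.PropositionalEquality using (_≡_; _≢_; refl; sym; trans; cong; cong₂; subst)
open import Relation.Nullary using (Dec; ¬_; yes; no)
open import Relation.Nullary.Decidable using (⌊_⌋; toWitness)

open import Defs hiding (sym)

private variable
  A B : Set
  n : ℕ

module _ (p : A → Bool) where

  count-accept : ∀ {x xs} → T (p x) → count p (x ∷ xs) ≡ suc (count p xs)
  count-accept px = cong length (filter-accept (T? ∘ p) px)

  count-reject : ∀ {x xs} → ¬ T (p x) → count p (x ∷ xs) ≡ count p xs
  count-reject ¬px = cong length (filter-reject (T? ∘ p) ¬px)

  count-none : (∀ x → ¬ T (p x)) → ∀ xs → count p xs ≡ 0
  count-none ¬p []       = refl
  count-none ¬p (x ∷ xs) = trans (count-reject (¬p x)) (count-none ¬p xs)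

  count-≤-length : ∀ xs → count p xs ≤ length xs
  count-≤-length = length-filter (T? ∘ p)

  count-++ : ∀ xs ys → count p (xs ++ ys) ≡ count p xs + count p ys
  count-++ xs ys = trans (cong length (filter-++ (T? ∘ p) xs ys)) (length-++ (filterᵇ p xs))

count-map : (p : B → Bool) (f : A → B) (xs : List A) → count p (List.map f xs) ≡ count (p ∘ f) xs
count-map p f []       = refl
count-map p f (x ∷ xs) with T? (p (f x))
... | yes px = trans (count-accept p px) (trans (cong suc (count-map p f xs)) (sym (count-accept (p ∘ f) px)))
... | no ¬px = trans (count-reject p ¬px) (trans (count-map p f xs) (sym (count-reject (p ∘ f) ¬px)))

count-tabulate : (p : A → Bool) (f : Fin n → A) → count p (tabulate f) ≡ count (p ∘ f) (allFin n)
count-tabulate {n = n} p f = trans (cong (count p) (sym (map-tabulate id f))) (count-map p f (allFin n))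

count-allFin-unique : (p : Fin n → Bool) (w : Fin n) → T (p w) → (∀ x → T (p x) → x ≡ w) →
                      count p (allFin n) ≡ 1
count-allFin-unique p zero pw unique =
  trans (count-accept p pw) (cong suc (trans (count-tabulate p suc) (count-none (p ∘ suc) ¬p∘suc (allFin _))))
  where
  ¬p∘suc : ∀ x → ¬ T (p (suc x))
  ¬p∘suc x px with () ← unique (suc x) px
count-allFin-unique p (suc w) pw unique =
  trans (count-reject p ¬p0) (trans (count-tabulate p suc)
        (count-allFin-unique (p ∘ suc) w pw (λ x px → suc-injective (unique (suc x) px))))
  where
  ¬p0 : ¬ T (p zero)
  ¬p0 p0 with () ← unique zero p0

count-allSubsets-suc : (P : Subset (suc n) → Bool) →
  count P (allSubsets (suc n)) ≡ count (P ∘ (true ∷_)) (allSubsets n) + count (P ∘ (false ∷_)) (allSubsets n)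
count-allSubsets-suc {n} P = trans (count-++ P (List.map (true ∷_) (allSubsets n)) _)
  (cong₂ _+_ (count-map P (true ∷_) (allSubsets n)) (count-map P (false ∷_) (allSubsets n)))

count-subsets+count-common-≤-2^ : ∀ n (P : Subset n → Bool) (Q : Fin n → Bool) →
  (∀ X → T (P X) → ∀ v → T (Q v) → v ∈ X) →
  count P (allSubsets n) + count Q (allFin n) ≤ 2 ^ n
count-subsets+count-common-≤-2^ zero P Q _ =
  ≤-trans (≤-reflexive (+-identityʳ _)) (count-≤-length P (allSubsets zero))
count-subsets+count-common-≤-2^ (suc n) P Q common = bound (T? (Q zero))
  where
  open ≤-Reasoning

  a : Bool → ℕ
  a b = count (P ∘ (b ∷_)) (allSubsets n)

  c : ℕ
  c = count (Q ∘ suc) (allFin n)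

  ih : ∀ b → a b + c ≤ 2 ^ n
  ih b = count-subsets+count-common-≤-2^ n (P ∘ (b ∷_)) (Q ∘ suc)
           (λ X PX v Qv → drop-there (common (b ∷ X) PX (suc v) Qv))

  2^n+2^n≡2^suc : 2 ^ n + 2 ^ n ≡ 2 ^ suc n
  2^n+2^n≡2^suc = cong (2 ^ n +_) (sym (+-identityʳ (2 ^ n)))

  bound : Dec (T (Q zero)) → count P (allSubsets (suc n)) + count Q (allFin (suc n)) ≤ 2 ^ suc n
  bound (yes q0) = begin
    count P (allSubsets (suc n)) + count Q (allFin (suc n))
      ≡⟨ cong₂ _+_ (count-allSubsets-suc P) (trans (count-accept Q q0) (cong suc (count-tabulate Q suc))) ⟩
    a true + a false + suc c  ≡⟨ cong (λ b → a true + b + suc c) (count-none (P ∘ (false ∷_)) zero∉ (allSubsets n)) ⟩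
    a true + 0 + suc c        ≡⟨ rearrange (a true) c ⟩
    (a true + c) + 1          ≤⟨ +-mono-≤ (ih true) (m^n>0 2 n) ⟩
    2 ^ n + 2 ^ n             ≡⟨ 2^n+2^n≡2^suc ⟩
    2 ^ suc n                 ∎
    where
    zero∉ : ∀ X → ¬ T (P (false ∷ X))
    zero∉ X PX with () ← common (false ∷ X) PX zero q0
    rearrange : ∀ x y → x + 0 + suc y ≡ (x + y) + 1
    rearrange = solve-∀
  bound (no ¬q0) = begin
    count P (allSubsets (suc n)) + count Q (allFin (suc n))
      ≡⟨ cong₂ _+_ (count-allSubsets-suc P) (trans (count-reject Q ¬q0) (count-tabulate Q suc)) ⟩
    a true + a false + c      ≤⟨ m≤m+n _ c ⟩
    a true + a false + c + c  ≡⟨ rearrange (a true) (a false) c ⟩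
    (a true + c) + (a false + c) ≤⟨ +-mono-≤ (ih true) (ih false) ⟩
    2 ^ n + 2 ^ n             ≡⟨ 2^n+2^n≡2^suc ⟩
    2 ^ suc n                 ∎
    where
    rearrange : ∀ x y z → x + y + z + z ≡ (x + z) + (y + z)
    rearrange = solve-∀

subsetEq-sound : {X Y : Subset n} → T (subsetEq X Y) → X ≡ Y
subsetEq-sound {X = []}    {[]}    _  = refl
subsetEq-sound {X = x ∷ X} {y ∷ Y} eq =
  let x≡y , X≡Y = Equivalence.to T-∧ eq in cong₂ _∷_ (toWitness x≡y) (subsetEq-sound X≡Y)

T-lookup⇒∈ : {S : Subset n} {v : Fin n} → T (lookup S v) → v ∈ S
T-lookup⇒∈ {S = S} {v} = lookup⇒[]= v S ∘ Equivalence.to T-≡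

∈⇒T-lookup : {S : Subset n} {v : Fin n} → v ∈ S → T (lookup S v)
∈⇒T-lookup = Equivalence.from T-≡ ∘ []=⇒lookup

∈-tabulate⁻ : {f : Fin n → Bool} {v : Fin n} → v ∈ Vec.tabulate f → T (f v)
∈-tabulate⁻ {f = f} {v} = subst T (lookup∘tabulate f v) ∘ ∈⇒T-lookup

∈-tabulate⁺ : {f : Fin n → Bool} {v : Fin n} → T (f v) → v ∈ Vec.tabulate f
∈-tabulate⁺ {f = f} {v} = T-lookup⇒∈ ∘ subst T (sym (lookup∘tabulate f v))

∈-allFin-all : (p : Fin n → Bool) → T (all p (allFin n)) → ∀ v → T (p v)
∈-allFin-all p all-p v = All.lookup (all⁺ p (allFin _) all-p) (∈-allFin v)

Disjoint : Subset n → Subset n → Set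
Disjoint S S′ = ∀ {v} → v ∈ S → v ∈ S′ → ⊥

∉⇒⁅⁆-disjoint : {v : Fin n} {S : Subset n} → v ∉ S → Disjoint ⁅ v ⁆ S
∉⇒⁅⁆-disjoint {v = v} v∉S w∈⁅v⁆ w∈S = v∉S (subst (_∈ _) (x∈⁅y⁆⇒x≡y v w∈⁅v⁆) w∈S)

module _ (G : Graph n) where

  ∈-closedNbhd⁻ : ∀ {S v} → v ∈ closedNbhd G S → v ∈ S ⊎ ∃ λ u → u ∈ S × T (adj G u v)
  ∈-closedNbhd⁻ {S} {v} v∈NS with Equivalence.to T-∨ (∈-tabulate⁻ v∈NS)
  ... | inj₁ v∈S = inj₁ (T-lookup⇒∈ v∈S)
  ... | inj₂ some-u with u , u∈S∧uv ← satisfied (any⁻ _ (allFin n) some-u) =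
    let u∈S , uv = Equivalence.to T-∧ u∈S∧uv in inj₂ (u , T-lookup⇒∈ u∈S , uv)

  ∈-closedNbhd⁺ˡ : ∀ {S v} → v ∈ S → v ∈ closedNbhd G S
  ∈-closedNbhd⁺ˡ v∈S = ∈-tabulate⁺ (Equivalence.from T-∨ (inj₁ (∈⇒T-lookup v∈S)))

  ∈-closedNbhd⁺ʳ : ∀ {S u v} → u ∈ S → T (adj G u v) → v ∈ closedNbhd G S
  ∈-closedNbhd⁺ʳ {u = u} u∈S uv = ∈-tabulate⁺ (Equivalence.from T-∨ (inj₂
    (any⁺ _ (lose (∈-allFin u) (Equivalence.from T-∧ (∈⇒T-lookup u∈S , uv))))))

  closedNbhd-disjoint : ∀ {S F} → Disjoint S (closedNbhd G F) → Disjoint (closedNbhd G S) F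
  closedNbhd-disjoint S∩NF=∅ v∈NS v∈F with ∈-closedNbhd⁻ v∈NS
  ... | inj₁ v∈S = S∩NF=∅ v∈S (∈-closedNbhd⁺ˡ v∈F)
  ... | inj₂ (u , u∈S , uv) =
    S∩NF=∅ u∈S (∈-closedNbhd⁺ʳ v∈F (subst T (Graph.sym G _ _) uv))

  ∈-forceStep⁻ : ∀ {C v} → v ∈ forceStep G C →
    v ∈ C ⊎ ∃ λ u → u ∈ C × T (adj G u v) × (∀ w → T (adj G u w) → w ≡ v ⊎ w ∈ C)
  ∈-forceStep⁻ {C} {v} v∈C′ with Equivalence.to T-∨ (∈-tabulate⁻ v∈C′)
  ... | inj₁ v∈C = inj₁ (T-lookup⇒∈ v∈C)
  ... | inj₂ some-u with u , forces ← satisfied (any⁻ _ (allFin n) some-u) =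
    let u∈C , uv∧rest = Equivalence.to T-∧ forces
        uv , rest     = Equivalence.to T-∧ uv∧rest
    in inj₂ (u , T-lookup⇒∈ u∈C , uv , only-v u rest)
    where
    only-v : ∀ u → T (all (λ w → not (adj G u w) ∨ ⌊ w ≟ v ⌋ ∨ lookup C w) (allFin n)) →
             ∀ w → T (adj G u w) → w ≡ v ⊎ w ∈ C
    only-v u rest w uw with adj G u w | ∈-allFin-all _ rest w
    ... | true | w≡v∨w∈C = Sum.map toWitness T-lookup⇒∈ (Equivalence.to T-∨ w≡v∨w∈C)

  fort-nonempty : ∀ {F} → T (isFort G F) → Nonempty F
  fort-nonempty fort with v , v∈F ← satisfied (any⁻ _ (allFin n) (proj₁ (Equivalence.to T-∧ fort))) =
    v , T-lookup⇒∈ v∈F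

  fort-no-unique-neighbour : ∀ {F u} → T (isFort G F) → u ∉ F → nbrCount G F u ≢ 1
  fort-no-unique-neighbour {F} {u} fort u∉F one
    with Equivalence.to T-∨ (∈-allFin-all _ (proj₂ (Equivalence.to T-∧ fort)) u)
  ... | inj₁ u∈F    = u∉F (T-lookup⇒∈ u∈F)
  ... | inj₂ not-one = subst (T ∘ not ∘ isOne G) one not-one

  nbrCount≡1 : ∀ {F u w} → w ∈ F → T (adj G u w) → (∀ x → x ∈ F → T (adj G u x) → x ≡ w) →
               nbrCount G F u ≡ 1
  nbrCount≡1 {w = w} w∈F uw unique = count-allFin-unique _ w
    (Equivalence.from T-∧ (∈⇒T-lookup w∈F , uw))
    (λ x x∈F∧ux → let x∈F , ux = Equivalence.to T-∧ x∈F∧ux in unique x (T-lookup⇒∈ x∈F) ux)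

  forceStep-disjoint-fort : ∀ {C F} → T (isFort G F) → Disjoint C F → Disjoint (forceStep G C) F
  forceStep-disjoint-fort {C} {F} fort C∩F=∅ {v} v∈C′ v∈F with ∈-forceStep⁻ v∈C′
  ... | inj₁ v∈C = C∩F=∅ v∈C v∈F
  ... | inj₂ (u , u∈C , uv , only-v) =
    fort-no-unique-neighbour fort (C∩F=∅ u∈C) (nbrCount≡1 v∈F uv v-only-F-neighbour)
    where
    v-only-F-neighbour : ∀ x → x ∈ F → T (adj G u x) → x ≡ v
    v-only-F-neighbour x x∈F ux with only-v x ux
    ... | inj₁ x≡v = x≡v
    ... | inj₂ x∈C = ⊥-elim (C∩F=∅ x∈C x∈F)

  iterate-preserves : (P : Subset n → Set) {f : Subset n → Subset n} → (∀ {C} → P C → P (f C)) →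
                      ∀ k {C} → P C → P (iterate G k f C)
  iterate-preserves P step zero    PC = PC
  iterate-preserves P step (suc k) PC = iterate-preserves P step k (step PC)

  observed-disjoint-fort : ∀ {S F} → T (isFort G F) → Disjoint S (closedNbhd G F) → Disjoint (observed G S) F
  observed-disjoint-fort {F = F} fort S∩NF=∅ =
    iterate-preserves (λ C → Disjoint C F) (forceStep-disjoint-fort fort) n (closedNbhd-disjoint S∩NF=∅)

  powerDominating-meets-closedNbhd-fort : ∀ {S F} → T (isFort G F) → T (isPowerDominating G S) →
                                          ¬ Disjoint S (closedNbhd G F)
  powerDominating-meets-closedNbhd-fort {S} {F} fort pd S∩NF=∅ with v , v∈F ← fort-nonempty {F} fort =
    observed-disjoint-fort {S} {F} fort S∩NF=∅ (T-lookup⇒∈ (∈-allFin-all (λ v → lookup (observed G S) v) pd v)) v∈F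

  powerDominating-⁅⁆⇒∈-closedNbhd-fort : ∀ {v F} → T (isFort G F) → T (isPowerDominating G ⁅ v ⁆) →
                                         v ∈ closedNbhd G F
  powerDominating-⁅⁆⇒∈-closedNbhd-fort {v} {F} fort pd with v ∈? closedNbhd G F
  ... | yes v∈NF = v∈NF
  ... | no  v∉NF = ⊥-elim (powerDominating-meets-closedNbhd-fort {F = F} fort pd (∉⇒⁅⁆-disjoint v∉NF))

proposition9 : ∀ (n : ℕ) (G : Graph n) → fortNbhdCount G ≤ 2 ^ n ∸ powerDomCoeff1 G
proposition9 n G = m+n≤o⇒m≤o∸n _ (count-subsets+count-common-≤-2^ n _ _ fortNbhd∋singletonPD)
  where
  fortNbhd∋singletonPD : ∀ X → T (any (λ F → isFort G F ∧ subsetEq (closedNbhd G F) X) (allSubsets n)) →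
                         ∀ v → T (isPowerDominating G ⁅ v ⁆) → v ∈ X
  fortNbhd∋singletonPD X X∈𝒩 v pd with F , isFort∧eq ← satisfied (any⁻ _ (allSubsets n) X∈𝒩) =
    let fort , NF≡X = Equivalence.to T-∧ isFort∧eq
    in subst (v ∈_) (subsetEq-sound NF≡X) (powerDominating-⁅⁆⇒∈-closedNbhd-fort G {F = F} fort pd)
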